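{- Let $r\ge 3$ and $p,q\ge0$ be integers with $p+q\ge1$, and let $s=p+q+2$. There exists an irreducible permutation of length $(r-1)(2s-5)$ in $\mathrm{Av}(\alpha_r,\beta_{pq})$; furthermore, this permutation has an expansible set of size $(r-1)(s-2)$.
   Context: $\alpha_r=12\cdots r$. $\beta_{pq}=\lambda\,(q+1)\,(q+2)\,\mu$ of length $p+q+2$, where $\lambda=(p+q+2)(p+q+1)\cdots(q+3)$ (length $p$) and $\mu=q(q-1)\cdots1$ (length $q$). $\mathrm{Av}(\alpha,\beta)$ is the set of permutations avoiding $\alpha$ and $\beta$. A permutation is irreducible if it has no two adjacent entries of the form $i+1,\,i$. A subset $E$ of the terms of an irreducible permutation $\theta$ in a class $X$ is expansible (with respect to $X$) if for every $N$, simultaneously replacing each term of $E$ by a decreasing segment of $N$ consecutive values (and relabelling to obtain a permutation) yields a permutation in $X$; here $X=\mathrm{Av}(\alpha_r,\beta_{pq})$. -}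

module Defs where

open import Data.Nat using (ℕ; zero; suc; _+_; _*_; _∸_; _<_; _<ᵇ_)
open import Data.Bool using (Bool; true; false; if_then_else_)
open import Data.List using (List; []; _∷_; _++_; map; upTo; length; sum; zip; concatMap; filter)
open import Data.List.Relation.Binary.Permutation.Propositional using (_↭_)
open import Data.List.Relation.Binary.Sublist.Propositional using (_⊆_)
open import Data.Product using (_×_; Σ; ∃; _,_)
open import Data.Unit using (⊤)
open import Data.Empty using (⊥)
open import Function.Bundles using (_⇔_)
open import Relation.Nullary using (¬_)
open import Relation.Binary.PropositionalEquality using (_≡_; _≢_)

IsPerm : ℕ → List ℕ → Set
IsPerm n xs = xs ↭ map suc (upTo n)

dec : ℕ → ℕ → List ℕ
dec a zero    = []
dec a (suc k) = a ∷ dec (a ∸ 1) k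

SameCmp : ℕ → ℕ → List ℕ → List ℕ → Set
SameCmp x y []       []       = ⊤
SameCmp x y (u ∷ us) (v ∷ vs) = ((x < u) ⇔ (y < v)) × ((u < x) ⇔ (v < y)) × SameCmp x y us vs
SameCmp x y _        _        = ⊥

OrderIso : List ℕ → List ℕ → Set
OrderIso []       []       = ⊤
OrderIso (x ∷ xs) (y ∷ ys) = SameCmp x y xs ys × OrderIso xs ys
OrderIso _        _        = ⊥

Contains : List ℕ → List ℕ → Set
Contains σ π = Σ (List ℕ) λ τ → (τ ⊆ σ) × OrderIso τ π

Avoids : List ℕ → List ℕ → Set
Avoids σ π = ¬ Contains σ π

alpha : ℕ → List ℕ
alpha r = map suc (upTo r)

beta : ℕ → ℕ → List ℕ
beta p q = dec (p + q + 2) p ++ (suc q ∷ suc (suc q) ∷ dec q q)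

InAv : ℕ → ℕ → ℕ → List ℕ → Set
InAv r p q σ = Avoids σ (alpha r) × Avoids σ (beta p q)

Irreducible : List ℕ → Set
Irreducible []           = ⊤
Irreducible (x ∷ [])     = ⊤
Irreducible (x ∷ y ∷ zs) = (x ≢ suc y) × Irreducible (y ∷ zs)

-- A subset E of the terms of θ is given by a list of marks aligned with θ.
count : List Bool → ℕ
count []           = 0
count (true ∷ bs)  = suc (count bs)
count (false ∷ bs) = count bs

weight : ℕ → Bool → ℕ
weight N true  = N
weight N false = 1

base : ℕ → List (ℕ × Bool) → ℕ → ℕ
base N []             v = 0
base N ((x , b) ∷ ps) v = (if x <ᵇ v then weight N b else 0) + base N ps v

-- replace each marked term by a decreasing run of N consecutive values,
-- relabelling so the result is a permutation of 1..(total size)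
expand : ℕ → List ℕ → List Bool → List ℕ
expand N θ E = go (zip θ E)
  where
  ps = zip θ E
  go : List (ℕ × Bool) → List ℕ
  go []             = []
  go ((x , b) ∷ rs) = dec (base N ps x + weight N b) (weight N b) ++ go rs

Expansible : ℕ → ℕ → ℕ → List ℕ → List Bool → Set
Expansible r p q θ E = (N : ℕ) → InAv r p q (expand (suc N) θ E)

-- Write r = n + 2 and p + q = m + 1.  The permutation θ is built from cells A k u (u ≤ m) and
-- B k v (v < m) in n + 1 layers k ≤ n.  Positions run through segments 0 … n + 1 and values
-- through blocks 0 … n + 1: segment k + 1 interleaves the A-cells of layer k + 1 with the
-- B-cells of layer k, block k + 1 interleaves the A-cells of layer k with the B-cells of layer
-- k + 1, and in both the cells are ordered by their slot 2u or 2v + 1, downwards along a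
-- segment and upwards along a block.
--
-- Every ascent between two cells raises the layer, so increasing subsequences have at most
-- n + 1 = r - 1 terms.  In an occurrence of β the entries before and above its central ascent
-- come from A-cells and those after and below it from B-cells, and each such A-cell has index
-- at least 2 more than each such B-cell.  Along either run the index strictly decreases
-- unless two entries come from one expanded cell; since exactly the A-cells of index ≤ q ∸ 1
-- and the B-cells of index ≥ q ∸ 1 are expanded, some A-cell of the first run has index ≤ q
-- while the first B-cell of the second has index ≥ q ∸ 1, which is impossible.  (If q = 0 the
-- A-cell found has index 0, which no cell before and above an ascent has; if p = 0 the first
-- B-cell would have index ≥ m.)  Finally, a cell is never the value-successor of the cell just
-- before it in position, as some third cell lies in between; hence θ is irreducible.

module Submission where

open import Defs
open import Data.Bool using (Bool; true; false; T; if_then_else_)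
open import Data.Empty using (⊥)
open import Data.List using (List; []; _∷_; _++_; map; length; upTo; applyUpTo; applyDownFrom; filter; zip)
open import Data.List.Membership.Propositional using (_∈_)
open import Data.List.Membership.Propositional.Properties using (∈-map⁺; ∈-++⁺ˡ; ∈-++⁺ʳ; ∈-applyDownFrom⁺)
open import Data.List.Properties
  using (length-map; length-++; length-upTo; length-applyDownFrom; map-++; map-upTo; map-cong; map-cong-local;
         map-∘; map-id; filter-accept; filter-reject; filter-none)
open import Data.List.Relation.Binary.Permutation.Propositional using (_↭_; ↭-sym; ↭-trans; ↭-reflexive; ↭⇒↭ₛ)
open import Data.List.Relation.Binary.Permutation.Propositional.Properties as Permₚ using (↭-length; filter-↭)
open import Data.List.Relation.Binary.Permutation.Setoid.Properties using (Unique-resp-↭)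
open import Data.List.Relation.Binary.Pointwise using (Pointwise; []; _∷_)
open import Data.List.Relation.Binary.Sublist.Propositional using (_⊆_; []; _∷_; _∷ʳ_; ⊆-refl)
open import Data.List.Relation.Binary.Sublist.Propositional.Properties using (All-resp-⊆; filter⁺; length-mono-≤)
open import Data.List.Relation.Unary.All as All using (All; []; _∷_)
import Data.List.Relation.Unary.All.Properties as Allₚ
open import Data.List.Relation.Unary.AllPairs as AllPairs using (AllPairs; []; _∷_)
import Data.List.Relation.Unary.AllPairs.Properties as AllPairsₚ
open import Data.List.Relation.Unary.Any using (Any; here; there)
open import Data.List.Relation.Unary.Linked as Linked using (Linked; []; [-]; _∷_)
open import Data.List.Relation.Unary.Linked.Properties as Linkedₚ using (AllPairs⇒Linked)
open import Data.Nat
  using (ℕ; zero; suc; pred; _+_; _*_; _∸_; _≤_; _<_; _>_; _<?_; _<ᵇ_; _≤ᵇ_; z≤n; s≤s; s≤s⁻¹; s<s⁻¹; >-nonZero)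
open import Data.Nat.Properties
open import Algebra.Properties.CommutativeSemigroup +-commutativeSemigroup using (interchange; x∙yz≈y∙xz)
open import Data.List.Sort ≤-decTotalOrder using (sort; sort-↭; sort-↗)
open import Data.Nat.Solver using (module +-*-Solver)
open +-*-Solver using (solve; _:+_; _:*_; _:=_; con)
open import Data.Product using (Σ; ∃-syntax; ∃₂; _×_; _,_; proj₁; proj₂; uncurry)
open import Data.Sum as Sum using (_⊎_; inj₁; inj₂; reduce)
open import Data.Unit using (tt)
open import Function using (_on_; _∘_; flip; id)
open import Function.Bundles using (Equivalence)
open import Level using (0ℓ)
open import Relation.Binary.Core using (Rel)
open import Relation.Binary.Definitions using (tri<; tri≈; tri>)
open import Relation.Binary.PropositionalEquality
  using (_≡_; _≢_; refl; sym; trans; cong; cong₂; subst; subst₂; setoid; module ≡-Reasoning)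
open import Relation.Nullary using (¬_; yes; no; contradiction; ofʸ; ofⁿ)


AllPairs-resp-⊆ : ∀ {X : Set} {R : Rel X 0ℓ} {xs ys} → xs ⊆ ys → AllPairs R ys → AllPairs R xs
AllPairs-resp-⊆ []             []         = []
AllPairs-resp-⊆ (_ ∷ʳ xs⊆ys)   (_ ∷ Rys)  = AllPairs-resp-⊆ xs⊆ys Rys
AllPairs-resp-⊆ (refl ∷ xs⊆ys) (Ry ∷ Rys) = All-resp-⊆ xs⊆ys Ry ∷ AllPairs-resp-⊆ xs⊆ys Rys

AllPairs-++⁻ : ∀ {X : Set} {R : Rel X 0ℓ} xs {ys} → AllPairs R (xs ++ ys) →
               AllPairs R xs × All (λ x → All (R x) ys) xs × AllPairs R ys
AllPairs-++⁻ []       Rys        = [] , [] , Rys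
AllPairs-++⁻ (x ∷ xs) (Rx ∷ Rxs) with AllPairs-++⁻ xs Rxs
... | Rxs′ , across , Rys = Allₚ.++⁻ˡ xs Rx ∷ Rxs′ , Allₚ.++⁻ʳ xs Rx ∷ across , Rys

AllPairs-All : ∀ {X : Set} {P : X → Set} {R : Rel X 0ℓ} {xs} → All P xs → AllPairs R xs →
               AllPairs (λ a b → P a × P b × R a b) xs
AllPairs-All []         []         = []
AllPairs-All (pa ∷ ps) (Ra ∷ Rs) = All.zipWith (λ (pb , r) → pa , pb , r) (ps , Ra) ∷ AllPairs-All ps Rs

Linked-All : ∀ {X : Set} {P : X → Set} {R : Rel X 0ℓ} {xs} → All P xs → Linked R xs →
             Linked (λ a b → P a × P b × R a b) xs
Linked-All _              []        = []
Linked-All _              [-]       = [-]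
Linked-All (pa ∷ pb ∷ ps) (r ∷ lnk) = (pa , pb , r) ∷ Linked-All (pb ∷ ps) lnk

⊆-map⁻ : ∀ {X Y : Set} (f : X → Y) xs {ys} → ys ⊆ map f xs → ∃[ zs ] zs ⊆ xs × map f zs ≡ ys
⊆-map⁻ f []       []           = [] , [] , refl
⊆-map⁻ f (x ∷ xs) (_ ∷ʳ ys⊆)   with ⊆-map⁻ f xs ys⊆
... | zs , zs⊆ , refl = zs , x ∷ʳ zs⊆ , refl
⊆-map⁻ f (x ∷ xs) (refl ∷ ys⊆) with ⊆-map⁻ f xs ys⊆
... | zs , zs⊆ , refl = x ∷ zs , refl ∷ zs⊆ , refl

Linked⇒Irreducible : ∀ {xs} → Linked (λ x y → x ≢ suc y) xs → Irreducible xs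
Linked⇒Irreducible []         = tt
Linked⇒Irreducible [-]        = tt
Linked⇒Irreducible (x≢ ∷ lnk) = x≢ , Linked⇒Irreducible lnk

increasing-length : ∀ {n xs} → Linked _<_ xs → All (_≤ n) xs → length xs ≤ suc n
increasing-length []                  []            = z≤n
increasing-length {n} {x ∷ xs} lnk bounded = s≤s (m+n≤o⇒m≤o (length xs) (from-head lnk bounded))
  where
  from-head : ∀ {x xs} → Linked _<_ (x ∷ xs) → All (_≤ n) (x ∷ xs) → length xs + x ≤ n
  from-head {xs = []}         [-]          (x≤n ∷ _)      = x≤n
  from-head {x} {xs = y ∷ xs} (x<y ∷ lnk′) (_ ∷ bounded′) = begin
    suc (length xs + x) ≡⟨ +-suc (length xs) x ⟨
    length xs + suc x   ≤⟨ +-monoʳ-≤ (length xs) x<y ⟩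
    length xs + y       ≤⟨ from-head lnk′ bounded′ ⟩
    n                   ∎
    where open ≤-Reasoning

head-below : ∀ {z Z} → Linked _<_ (z ∷ Z) → All (z <_) Z
head-below [-]          = []
head-below (z<z′ ∷ lnk) = Linkedₚ.Linked⇒All <-trans z<z′ lnk

module _ {X : Set} {R : Rel X 0ℓ} {P : X → Set} (g : X → ℕ) (c : ℕ) where

  descending-chain-reaches : (∀ {a b} → P a → P b → R a b → g b < g a ⊎ g a ≤ c) →
                  ∀ {z zs} → Linked R (z ∷ zs) → All P (z ∷ zs) → g z ≤ c + length zs →
                  Any (λ w → g w ≤ c) (z ∷ zs)
  descending-chain-reaches step {zs = []}     _         _             bound = here (subst (_ ≤_) (+-identityʳ c) bound)
  descending-chain-reaches step {zs = _ ∷ zs} (r ∷ lnk) (pa ∷ pb ∷ ps) bound with step pa pb r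
  ... | inj₂ ga≤c = here ga≤c
  ... | inj₁ gb<ga = there (descending-chain-reaches step lnk (pb ∷ ps)
                             (s≤s⁻¹ (<-≤-trans gb<ga (≤-trans bound (≤-reflexive (+-suc c (length zs)))))))

  descending-chain-head : (∀ {a b} → P a → P b → R a b → g b < g a ⊎ c ≤ g a) →
               ∀ {z zs} → Linked R (z ∷ zs) → All P (z ∷ zs) → length zs ≤ g z ⊎ c ≤ g z
  descending-chain-head step {zs = []}     _         _             = inj₁ z≤n
  descending-chain-head step {zs = _ ∷ zs} (r ∷ lnk) (pa ∷ pb ∷ ps) with step pa pb r
  ... | inj₂ c≤ga  = inj₂ c≤ga
  ... | inj₁ gb<ga with descending-chain-head step lnk (pb ∷ ps)
  ...   | inj₁ len≤gb = inj₁ (<-≤-trans (s≤s len≤gb) gb<ga)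
  ...   | inj₂ c≤gb   = inj₂ (≤-trans c≤gb (<⇒≤ gb<ga))


-- Order isomorphisms and occurrences of α and β

OrderIso-length : ∀ {xs ys} → OrderIso xs ys → length xs ≡ length ys
OrderIso-length {[]}    {[]}    _         = refl
OrderIso-length {_ ∷ _} {_ ∷ _} (_ , iso) = cong suc (OrderIso-length iso)

SameCmp-++⁻ : ∀ {x y} xs₁ {xs₂} ys₁ {ys₂} → length xs₁ ≡ length ys₁ →
              SameCmp x y (xs₁ ++ xs₂) (ys₁ ++ ys₂) → SameCmp x y xs₁ ys₁ × SameCmp x y xs₂ ys₂
SameCmp-++⁻ []        []        _   cmp            = tt , cmp
SameCmp-++⁻ (_ ∷ xs₁) (_ ∷ ys₁) len (<⇔ , >⇔ , cmp) with SameCmp-++⁻ xs₁ ys₁ (suc-injective len) cmp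
... | cmp₁ , cmp₂ = (<⇔ , >⇔ , cmp₁) , cmp₂

SameCmp-below : ∀ {x y xs ys} → SameCmp x y xs ys → All (_< y) ys → All (_< x) xs
SameCmp-below {xs = []}    {[]}    _             []         = []
SameCmp-below {xs = _ ∷ _} {_ ∷ _} (_ , >⇔ , cmp) (v<y ∷ below) =
  Equivalence.from >⇔ v<y ∷ SameCmp-below cmp below

SameCmps-below : ∀ {xs₁ ys₁ xs₂ ys₂} → Pointwise (λ x y → SameCmp x y xs₂ ys₂) xs₁ ys₁ →
                 All (λ y → All (_< y) ys₂) ys₁ → All (λ x → All (_< x) xs₂) xs₁
SameCmps-below []           []             = []
SameCmps-below (cmp ∷ cmps) (below ∷ belows) = SameCmp-below cmp below ∷ SameCmps-below cmps belows

OrderIso-increasing : ∀ {xs ys} → OrderIso xs ys → Linked _<_ ys → Linked _<_ xs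
OrderIso-increasing {[]}        {[]}        _                   _           = []
OrderIso-increasing {_ ∷ []}    {_ ∷ []}    _                   _           = [-]
OrderIso-increasing {_ ∷ _ ∷ _} {_ ∷ _ ∷ _} ((<⇔ , _ , _) , iso) (y< ∷ lnk) =
  Equivalence.from <⇔ y< ∷ OrderIso-increasing iso lnk

OrderIso-decreasing : ∀ {xs ys} → OrderIso xs ys → Linked _>_ ys → Linked _>_ xs
OrderIso-decreasing {[]}        {[]}        _                   _           = []
OrderIso-decreasing {_ ∷ []}    {_ ∷ []}    _                   _           = [-]
OrderIso-decreasing {_ ∷ _ ∷ _} {_ ∷ _ ∷ _} ((_ , >⇔ , _) , iso) (y> ∷ lnk) =
  Equivalence.from >⇔ y> ∷ OrderIso-decreasing iso lnk

OrderIso-split : ∀ {X : Set} (f : X → ℕ) τ ys₁ {ys₂} → OrderIso (map f τ) (ys₁ ++ ys₂) →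
  ∃₂ λ τ₁ τ₂ → τ ≡ τ₁ ++ τ₂ × OrderIso (map f τ₁) ys₁ ×
               Pointwise (λ x y → SameCmp x y (map f τ₂) ys₂) (map f τ₁) ys₁ × OrderIso (map f τ₂) ys₂
OrderIso-split f τ       []        iso         = [] , τ , refl , tt , [] , iso
OrderIso-split f (t ∷ τ) (y ∷ ys₁) (cmp , iso) with OrderIso-split f τ ys₁ iso
... | τ₁ , τ₂ , refl , iso₁ , across , iso₂
  with SameCmp-++⁻ (map f τ₁) ys₁ (OrderIso-length iso₁) (subst (λ zs → SameCmp (f t) y zs _) (map-++ f τ₁ τ₂) cmp)
... | cmp₁ , cmp₂ = t ∷ τ₁ , τ₂ , refl , (cmp₁ , iso₁) , cmp₂ ∷ across , iso₂

length-dec : ∀ c k → length (dec c k) ≡ k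
length-dec c zero    = refl
length-dec c (suc k) = cong suc (length-dec (c ∸ 1) k)

dec-≤ : ∀ c k → All (_≤ c) (dec c k)
dec-≤ c zero    = []
dec-≤ c (suc k) = ≤-refl ∷ All.map (λ v≤ → ≤-trans v≤ (m∸n≤m c 1)) (dec-≤ (c ∸ 1) k)

dec-above : ∀ a k → All (a <_) (dec (k + a) k)
dec-above a zero    = []
dec-above a (suc k) = s≤s (m≤n+m a k) ∷ dec-above a k

dec-decreasing : ∀ a k → Linked _>_ (dec (k + a) k)
dec-decreasing a zero          = []
dec-decreasing a (suc zero)    = [-]
dec-decreasing a (suc (suc k)) = ≤-refl ∷ dec-decreasing a (suc k)

alpha-increasing : ∀ r → Linked _<_ (alpha r)
alpha-increasing r = subst (Linked _<_) (sym (map-upTo suc r)) (Linkedₚ.applyUpTo⁺₂ suc r (λ i → n<1+n (suc i)))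

alpha-occurrence : ∀ {X : Set} (f : X → ℕ) r {τ} → OrderIso (map f τ) (alpha r) →
                   Linked (_<_ on f) τ × length τ ≡ r
alpha-occurrence f r {τ} iso =
  Linkedₚ.map⁻ (OrderIso-increasing iso (alpha-increasing r)) ,
  trans (sym (length-map f τ)) (trans (OrderIso-length iso) (trans (length-map suc (upTo r)) (length-upTo r)))

record BetaOccurrence {X : Set} (f : X → ℕ) (p q : ℕ) (τ : List X) : Set where
  field
    front            : List X
    x y              : X
    back             : List X
    split            : τ ≡ front ++ x ∷ y ∷ back
    front-length     : length front ≡ p
    back-length      : length back ≡ q
    front-decreasing : Linked (_>_ on f) front
    front-above      : All (λ u → f y < f u) front
    x<y              : f x < f y
    back-below       : All (λ v → f v < f x) back
    back-decreasing  : Linked (_>_ on f) back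

beta-occurrence : ∀ {X : Set} (f : X → ℕ) p q {τ} → OrderIso (map f τ) (beta p q) → BetaOccurrence f p q τ
beta-occurrence f p q {τ} iso with OrderIso-split f τ (dec (p + q + 2) p) iso
... | front , x ∷ y ∷ back , refl , iso₁ , across , ((<⇔ , _ , cmp) , iso₂) = record
  { front            = front
  ; x                = x
  ; y                = y
  ; back             = back
  ; split            = refl
  ; front-length     = trans (sym (length-map f front)) (trans (OrderIso-length iso₁) (length-dec _ p))
  ; back-length      = trans (sym (length-map f back)) (trans (OrderIso-length (proj₂ iso₂)) (length-dec q q))
  ; front-decreasing = Linkedₚ.map⁻ (OrderIso-decreasing iso₁
                         (subst (λ c → Linked _>_ (dec c p)) λ-top (dec-decreasing (2 + q) p)))
  ; front-above      = Allₚ.map⁻ (All.map (All.head ∘ All.tail) (SameCmps-below across λ-above))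
  ; x<y              = Equivalence.from <⇔ ≤-refl
  ; back-below       = Allₚ.map⁻ (SameCmp-below cmp μ-range)
  ; back-decreasing  = Linkedₚ.map⁻ (OrderIso-decreasing (proj₂ iso₂)
                         (subst (λ c → Linked _>_ (dec c q)) (+-identityʳ q) (dec-decreasing 0 q)))
  }
  where
  λ-top : p + (2 + q) ≡ p + q + 2
  λ-top = trans (cong (p +_) (+-comm 2 q)) (sym (+-assoc p q 2))
  μ-range : All (_< suc q) (dec q q)
  μ-range = All.map s≤s (dec-≤ q q)
  λ-above : All (λ v → All (_< v) (suc q ∷ suc (suc q) ∷ dec q q)) (dec (p + q + 2) p)
  λ-above = subst (λ c → All (λ v → All (_< v) (suc q ∷ suc (suc q) ∷ dec q q)) (dec c p)) λ-top
    (All.map (λ q+2< → <-trans (n<1+n _) q+2< ∷ q+2< ∷ All.map (λ v< → <-trans v< (<-trans (n<1+n _) q+2<)) μ-range)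
             (dec-above (2 + q) p))


rank : List ℕ → ℕ → ℕ
rank U y = suc (length (filter (_<? y) U))

rank-mono : ∀ U {x y} → x ≤ y → rank U x ≤ rank U y
rank-mono U x≤y = s≤s (length-mono-≤ (filter⁺ (_<? _) (_<? _) (λ { refl z<x → <-≤-trans z<x x≤y }) (⊆-refl {x = U})))

rank-strict : ∀ {U x y} → x ∈ U → x < y → rank U x < rank U y
rank-strict {x ∷ U} {x} {y} (here refl) x<y
  rewrite filter-reject (_<? x) {x} {U} (<-irrefl refl) | filter-accept (_<? y) {x} {U} x<y =
  s≤s (s≤s (≤-pred (rank-mono U (<⇒≤ x<y))))
rank-strict {z ∷ U} {x} {y} (there x∈U) x<y with z <? x | z <? y
... | yes z<x | yes z<y
  rewrite filter-accept (_<? x) {z} {U} z<x | filter-accept (_<? y) {z} {U} z<y = s≤s (rank-strict x∈U x<y)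
... | yes z<x | no z≮y  = contradiction (<-trans z<x x<y) z≮y
... | no z≮x  | yes z<y
  rewrite filter-reject (_<? x) {z} {U} z≮x | filter-accept (_<? y) {z} {U} z<y = m≤n⇒m≤1+n (rank-strict x∈U x<y)
... | no z≮x  | no z≮y
  rewrite filter-reject (_<? x) {z} {U} z≮x | filter-reject (_<? y) {z} {U} z≮y = rank-strict x∈U x<y

rank-resp-↭ : ∀ {U V} → U ↭ V → ∀ y → rank U y ≡ rank V y
rank-resp-↭ U↭V y = cong suc (↭-length (filter-↭ (_<? y) U↭V))

rank-increasing : ∀ {Z} → Linked _<_ Z → map (rank Z) Z ≡ map suc (upTo (length Z))
rank-increasing []                 = refl
rank-increasing {z ∷ Z} increasing = cong₂ _∷_ rank-head rank-tail
  where
  z<Z : All (z <_) Z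
  z<Z = head-below increasing

  rank-head : rank (z ∷ Z) z ≡ 1
  rank-head rewrite filter-reject (_<? z) {z} {Z} (<-irrefl refl) =
    cong (suc ∘ length) (filter-none (_<? z) (All.map (λ z< < → <-asym z< <) z<Z))

  rank-tail : map (rank (z ∷ Z)) Z ≡ map suc (applyUpTo suc (length Z))
  rank-tail = begin
    map (rank (z ∷ Z)) Z         ≡⟨ map-cong-local (All.map (λ z<y → cong (suc ∘ length) (filter-accept (_<? _) z<y)) z<Z) ⟩
    map (suc ∘ rank Z) Z         ≡⟨ map-∘ Z ⟩
    map suc (map (rank Z) Z)     ≡⟨ cong (map suc) (rank-increasing (Linked.tail increasing)) ⟩
    map suc (map suc (upTo _))   ≡⟨ cong (map suc) (map-upTo suc (length Z)) ⟩
    map suc (applyUpTo suc _)    ∎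
    where open ≡-Reasoning

rank-↭ : ∀ U → AllPairs _≢_ U → map (rank U) U ↭ map suc (upTo (length U))
rank-↭ U distinct = ↭-trans (Permₚ.map⁺ (rank U) (↭-sym sorted↭U)) (↭-reflexive (begin
  map (rank U) Z                ≡⟨ map-cong (rank-resp-↭ (↭-sym sorted↭U)) Z ⟩
  map (rank Z) Z                ≡⟨ rank-increasing (Linked.zipWith (uncurry ≤∧≢⇒<) (sort-↗ U , Z-distinct)) ⟩
  map suc (upTo (length Z))     ≡⟨ cong (map suc ∘ upTo) (↭-length sorted↭U) ⟩
  map suc (upTo (length U))     ∎))
  where
  open ≡-Reasoning
  Z = sort U
  sorted↭U = sort-↭ U
  Z-distinct : Linked _≢_ Z
  Z-distinct = AllPairs⇒Linked (Unique-resp-↭ (setoid ℕ) (↭⇒↭ₛ (↭-sym sorted↭U)) distinct)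


blocks : ℕ → List (ℕ × Bool) → List (ℕ × Bool) → List ℕ
blocks N ps []             = []
blocks N ps ((x , b) ∷ rs) = dec (base N ps x + weight N b) (weight N b) ++ blocks N ps rs

module _ (N : ℕ) (θ : List ℕ) (E : List Bool) where

  -- The local function through which `expand` recurses cannot be named from
  -- here, so it is recovered as the solution of the metavariable `go`.
  private mutual
    go : List (ℕ × Bool) → List ℕ
    go = _

    expand≡go : expand N θ E ≡ go (zip θ E)
    expand≡go with zip θ E
    ... | _ = refl

  private
    go≡blocks : ∀ rs → go rs ≡ blocks N (zip θ E) rs
    go≡blocks []             = refl
    go≡blocks ((x , b) ∷ rs) = cong (dec (base N (zip θ E) x + weight N b) (weight N b) ++_) (go≡blocks rs)

  expand≡blocks : expand N θ E ≡ blocks N (zip θ E) (zip θ E)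
  expand≡blocks = trans expand≡go (go≡blocks (zip θ E))

if<ᵇ-mono : ∀ w z {x y} → x ≤ y → (if z <ᵇ x then w else 0) ≤ (if z <ᵇ y then w else 0)
if<ᵇ-mono w z {x} {y} x≤y with z <ᵇ x | <ᵇ-reflects-< z x | z <ᵇ y | <ᵇ-reflects-< z y
... | false | _       | _     | _       = z≤n
... | true  | _       | true  | _       = ≤-refl
... | true  | ofʸ z<x | false | ofⁿ z≮y = contradiction (<-≤-trans z<x x≤y) z≮y

if<ᵇ-irrefl : ∀ w x → (if x <ᵇ x then w else 0) ≡ 0
if<ᵇ-irrefl w x with x <ᵇ x | <ᵇ-reflects-< x x
... | false | _       = refl
... | true  | ofʸ x<x = contradiction x<x (<-irrefl refl)

if<ᵇ-accept : ∀ w {x y} → x < y → (if x <ᵇ y then w else 0) ≡ w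
if<ᵇ-accept w {x} {y} x<y with x <ᵇ y | <ᵇ-reflects-< x y
... | true  | _       = refl
... | false | ofⁿ x≮y = contradiction x<y x≮y

base-mono : ∀ N ps {x y} → x ≤ y → base N ps x ≤ base N ps y
base-mono N []             x≤y = z≤n
base-mono N ((z , b) ∷ ps) x≤y = +-mono-≤ (if<ᵇ-mono (weight N b) z x≤y) (base-mono N ps x≤y)

base-step : ∀ N {ps x b y} → (x , b) ∈ ps → x < y → base N ps x + weight N b ≤ base N ps y
base-step N {(x , b) ∷ ps} {y = y} (here refl) x<y
  rewrite if<ᵇ-irrefl (weight N b) x | if<ᵇ-accept (weight N b) x<y =
  ≤-trans (≤-reflexive (+-comm (base N ps x) (weight N b))) (+-monoʳ-≤ (weight N b) (base-mono N ps (<⇒≤ x<y)))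
base-step N {(z , c) ∷ ps} {x} {b} (there x∈ps) x<y =
  ≤-trans (≤-reflexive (+-assoc (if z <ᵇ x then weight N c else 0) (base N ps x) (weight N b)))
          (+-mono-≤ (if<ᵇ-mono (weight N c) z (<⇒≤ x<y)) (base-step N x∈ps x<y))


-- Cells and their position and value orders

data Cell : Set where
  A B : ℕ → ℕ → Cell

layer segment block slot index : Cell → ℕ
layer (A k _) = k
layer (B k _) = k
segment (A k _) = k
segment (B k _) = suc k
block (A k _) = suc k
block (B k _) = k
slot (A _ u) = 2 * u
slot (B _ v) = suc (2 * v)
index (A _ u) = u
index (B _ v) = v

data _≺ₚ_ (s t : Cell) : Set where
  earlier-segment : segment s < segment t → s ≺ₚ t
  same-segment    : segment s ≡ segment t → slot t < slot s → s ≺ₚ t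

data _≺ᵥ_ (s t : Cell) : Set where
  lower-block : block s < block t → s ≺ᵥ t
  same-block  : block s ≡ block t → slot s < slot t → s ≺ᵥ t

Valid : ℕ → ℕ → Cell → Set
Valid m n (A k u) = k ≤ n × u ≤ m
Valid m n (B k v) = k ≤ n × v < m

data IsA : Cell → Set where
  A-cell : ∀ {k u} → IsA (A k u)

data IsB : Cell → Set where
  B-cell : ∀ {k v} → IsB (B k v)

≺ₚ-irrefl : ∀ {s} → ¬ s ≺ₚ s
≺ₚ-irrefl (earlier-segment σ<σ) = <-irrefl refl σ<σ
≺ₚ-irrefl (same-segment _ s<s)  = <-irrefl refl s<s

≺ₚ-asym : ∀ {s t} → s ≺ₚ t → ¬ t ≺ₚ s
≺ₚ-asym (earlier-segment σ<) (earlier-segment σ>) = <-asym σ< σ>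
≺ₚ-asym (earlier-segment σ<) (same-segment σ≡ _)  = <-irrefl (sym σ≡) σ<
≺ₚ-asym (same-segment σ≡ _)  (earlier-segment σ>) = <-irrefl (sym σ≡) σ>
≺ₚ-asym (same-segment _ t<s) (same-segment _ s<t) = <-asym t<s s<t

≺ₚ-trans : ∀ {s t u} → s ≺ₚ t → t ≺ₚ u → s ≺ₚ u
≺ₚ-trans (earlier-segment σ<)  (earlier-segment σ<′) = earlier-segment (<-trans σ< σ<′)
≺ₚ-trans (earlier-segment σ<)  (same-segment σ≡ _)   = earlier-segment (<-≤-trans σ< (≤-reflexive σ≡))
≺ₚ-trans (same-segment σ≡ _)   (earlier-segment σ<)  = earlier-segment (≤-<-trans (≤-reflexive σ≡) σ<)
≺ₚ-trans (same-segment σ≡ t<s) (same-segment σ≡′ u<t) = same-segment (trans σ≡ σ≡′) (<-trans u<t t<s)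

≺ᵥ-asym : ∀ {s t} → s ≺ᵥ t → ¬ t ≺ᵥ s
≺ᵥ-asym (lower-block β<)    (lower-block β>)    = <-asym β< β>
≺ᵥ-asym (lower-block β<)    (same-block β≡ _)   = <-irrefl (sym β≡) β<
≺ᵥ-asym (same-block β≡ _)   (lower-block β>)    = <-irrefl (sym β≡) β>
≺ᵥ-asym (same-block _ s<t)  (same-block _ t<s)  = <-asym s<t t<s

block-slot-injective : ∀ {s t} → block s ≡ block t → slot s ≡ slot t → s ≡ t
block-slot-injective {A k u} {A k′ u′} β≡ σ≡ = cong₂ A (suc-injective β≡) (*-cancelˡ-≡ u u′ 2 σ≡)
block-slot-injective {A _ u} {B _ v}   _  σ≡ = contradiction σ≡ (even≢odd u v)
block-slot-injective {B _ v} {A _ u}   _  σ≡ = contradiction (sym σ≡) (even≢odd u v)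
block-slot-injective {B k v} {B k′ v′} β≡ σ≡ = cong₂ B β≡ (*-cancelˡ-≡ v v′ 2 (suc-injective σ≡))

≺ᵥ-trichotomy : ∀ s t → s ≡ t ⊎ s ≺ᵥ t ⊎ t ≺ᵥ s
≺ᵥ-trichotomy s t with <-cmp (block s) (block t) | <-cmp (slot s) (slot t)
... | tri< β< _ _  | _            = inj₂ (inj₁ (lower-block β<))
... | tri> _ _ β>  | _            = inj₂ (inj₂ (lower-block β>))
... | tri≈ _ β≡ _  | tri< σ< _ _  = inj₂ (inj₁ (same-block β≡ σ<))
... | tri≈ _ β≡ _  | tri> _ _ σ>  = inj₂ (inj₂ (same-block (sym β≡) σ>))
... | tri≈ _ β≡ _  | tri≈ _ σ≡ _  = inj₁ (block-slot-injective β≡ σ≡)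

segment-mono : ∀ {s t} → s ≺ₚ t → segment s ≤ segment t
segment-mono (earlier-segment σ<) = <⇒≤ σ<
segment-mono (same-segment σ≡ _)  = ≤-reflexive σ≡

block-mono : ∀ {s t} → s ≺ᵥ t → block s ≤ block t
block-mono (lower-block β<)  = <⇒≤ β<
block-mono (same-block β≡ _) = ≤-reflexive β≡

≺ₚ-slot : ∀ {s t} → s ≺ₚ t → segment t ≤ segment s → slot t < slot s
≺ₚ-slot (earlier-segment σ<) σ≥ = contradiction σ≥ (<⇒≱ σ<)
≺ₚ-slot (same-segment _ t<s) _  = t<s

≺ᵥ-slot : ∀ {s t} → s ≺ᵥ t → block t ≤ block s → slot s < slot t
≺ᵥ-slot (lower-block β<)    β≥ = contradiction β≥ (<⇒≱ β<)
≺ᵥ-slot (same-block _ s<t)  _  = s<t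

layer≤segment : ∀ c → layer c ≤ segment c
layer≤segment (A _ _) = ≤-refl
layer≤segment (B k _) = n≤1+n k

segment≤1+layer : ∀ c → segment c ≤ suc (layer c)
segment≤1+layer (A k _) = n≤1+n k
segment≤1+layer (B _ _) = ≤-refl

layer≤block : ∀ c → layer c ≤ block c
layer≤block (A k _) = n≤1+n k
layer≤block (B _ _) = ≤-refl

block≤1+layer : ∀ c → block c ≤ suc (layer c)
block≤1+layer (A _ _) = ≤-refl
block≤1+layer (B k _) = n≤1+n k

segment+block : ∀ c → segment c + block c ≡ suc (2 * layer c)
segment+block (A k _) = trans (+-suc k k) (cong (λ l → suc (k + l)) (sym (+-identityʳ k)))
segment+block (B k _) = cong (λ l → suc (k + l)) (sym (+-identityʳ k))

even<odd : ∀ i → 2 * i < suc (2 * i)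
even<odd i = n<1+n (2 * i)

odd<even : ∀ {i j} → i < j → suc (2 * i) < 2 * j
odd<even {i} i<j = <-≤-trans (≤-reflexive (sym (*-suc 2 i))) (*-monoʳ-≤ 2 i<j)

odd<even⇒< : ∀ {v u} → suc (2 * v) < 2 * u → v < u
odd<even⇒< {v} {u} h = *-cancelˡ-< 2 v u (<-trans (n<1+n _) h)

Ascent : Rel Cell 0ℓ
Ascent s t = s ≺ₚ t × s ≺ᵥ t

-- Positions are read from left to right and values from bottom to top.
NorthWest SouthEast : Cell → Cell → Cell → Set
NorthWest x y z = z ≺ₚ x × y ≺ᵥ z
SouthEast x y w = y ≺ₚ w × w ≺ᵥ x

ascent-segment+block : ∀ {s t} → Ascent s t → segment s + block s < segment t + block t
ascent-segment+block (earlier-segment σ< , s≺ᵥt)          = +-mono-<-≤ σ< (block-mono s≺ᵥt)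
ascent-segment+block (same-segment σ≡ _ , lower-block β<)  = +-mono-≤-< (≤-reflexive σ≡) β<
ascent-segment+block (same-segment _ t<s , same-block _ s<t) = contradiction t<s (<-asym s<t)

ascent-layer : ∀ {s t} → Ascent s t → layer s < layer t
ascent-layer {s} {t} asc =
  *-cancelˡ-< 2 _ _ (s<s⁻¹ (subst₂ _<_ (segment+block s) (segment+block t) (ascent-segment+block asc)))

northwest-isA : ∀ {x y z} → Ascent x y → NorthWest x y z → IsA z
northwest-isA {z = A _ _} _ _ = A-cell
northwest-isA {x} {y} {B k _} asc (z≺x , y≺z) = contradiction (ascent-layer asc) (≤⇒≯ (begin
  layer y ≤⟨ layer≤block y ⟩
  block y ≤⟨ block-mono y≺z ⟩
  k       ≤⟨ s≤s⁻¹ (≤-trans (segment-mono z≺x) (segment≤1+layer x)) ⟩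
  layer x ∎))
  where open ≤-Reasoning

southeast-isB : ∀ {x y w} → Ascent x y → SouthEast x y w → IsB w
southeast-isB {w = B _ _} _ _ = B-cell
southeast-isB {x} {y} {A k _} asc (y≺w , w≺x) = contradiction (ascent-layer asc) (≤⇒≯ (begin
  layer y   ≤⟨ layer≤segment y ⟩
  segment y ≤⟨ segment-mono y≺w ⟩
  k         ≤⟨ s≤s⁻¹ (≤-trans (block-mono w≺x) (block≤1+layer x)) ⟩
  layer x   ∎))
  where open ≤-Reasoning

northwest-index>0 : ∀ {x y z} → Ascent x y → NorthWest x y z → 0 < index z
northwest-index>0 {z = B _ _} asc nw with () ← northwest-isA asc nw
northwest-index>0 {z = A _ (suc _)} _ _ = s≤s z≤n
northwest-index>0 {z = A _ zero} _ (same-segment _ () , _)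
northwest-index>0 {z = A _ zero} _ (_ , same-block _ ())
northwest-index>0 {x} {y} {A k zero} asc (earlier-segment k<segment , lower-block block<1+k) =
  contradiction (ascent-layer asc) (≤⇒≯ (begin
    layer y ≤⟨ layer≤block y ⟩
    block y ≤⟨ s≤s⁻¹ block<1+k ⟩
    k       ≤⟨ s≤s⁻¹ (<-≤-trans k<segment (segment≤1+layer x)) ⟩
    layer x ∎))
  where open ≤-Reasoning

northwest-southeast-gap : ∀ {x y z w} →
  Ascent x y → NorthWest x y z → SouthEast x y w → 2 + index w ≤ index z
northwest-southeast-gap {z = B _ _} asc nw _ with () ← northwest-isA asc nw
northwest-southeast-gap {w = A _ _} asc _ se with () ← southeast-isB asc se
northwest-southeast-gap {A _ _} {A _ _} {A _ _} {B _ _} asc (a≺x , y≺a) _ =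
  contradiction (ascent-layer asc) (≤⇒≯ (≤-trans (s≤s⁻¹ (block-mono y≺a)) (segment-mono a≺x)))
northwest-southeast-gap {B _ _} {B _ _} {A _ _} {B _ _} asc _ (y≺b , b≺x) =
  contradiction (ascent-layer asc) (≤⇒≯ (≤-trans (s≤s⁻¹ (segment-mono y≺b)) (block-mono b≺x)))
northwest-southeast-gap {A i ux} {B i′ vy} {A k u} {B k′ v} asc (a≺x , y≺a) (y≺b , b≺x) = ≤-trans (s≤s v<ux) ux<u
  where
  i<i′ = ascent-layer asc
  ux<u : ux < u
  ux<u = *-cancelˡ-< 2 _ _ (≺ₚ-slot a≺x (s≤s⁻¹ (<-≤-trans i<i′ (block-mono y≺a))))
  v<ux : v < ux
  v<ux = odd<even⇒< (≺ᵥ-slot b≺x (<-≤-trans i<i′ (s≤s⁻¹ (segment-mono y≺b))))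
northwest-southeast-gap {B i vx} {A i′ uy} {A k u} {B k′ v} asc@(x≺y , _) (a≺x , y≺a) (y≺b , b≺x) =
  ≤-trans (s≤s (≤-trans v<uy uy≤vx)) vx<u
  where
  i<i′ = ascent-layer asc
  i′≤k = s≤s⁻¹ (block-mono y≺a)
  vx<u : vx < u
  vx<u = odd<even⇒< (≺ₚ-slot a≺x (≤-trans i<i′ i′≤k))
  uy≤vx : uy ≤ vx
  uy≤vx = *-cancelˡ-≤ 2 (s≤s⁻¹ (≺ₚ-slot x≺y (≤-trans i′≤k (segment-mono a≺x))))
  v<uy : v < uy
  v<uy = odd<even⇒< (≺ₚ-slot y≺b (≤-trans (s≤s (block-mono b≺x)) i<i′))

A-descent : ∀ {k u k′ u′} → A k u ≺ₚ A k′ u′ → A k′ u′ ≺ᵥ A k u → u′ < u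
A-descent (earlier-segment k<k′)  v = contradiction (s≤s⁻¹ (block-mono v)) (<⇒≱ k<k′)
A-descent (same-segment _ 2u′<2u) _ = *-cancelˡ-< 2 _ _ 2u′<2u

B-descent : ∀ {k v k′ v′} → B k v ≺ₚ B k′ v′ → B k′ v′ ≺ᵥ B k v → v′ < v
B-descent (earlier-segment k<k′) w = contradiction (block-mono w) (<⇒≱ (s<s⁻¹ k<k′))
B-descent (same-segment _ v′<v)  _ = *-cancelˡ-< 2 _ _ (s<s⁻¹ v′<v)

valid-layer : ∀ {m n c} → Valid m n c → layer c ≤ n
valid-layer {c = A _ _} (k≤n , _) = k≤n
valid-layer {c = B _ _} (k≤n , _) = k≤n

valid-A-index : ∀ {m n c} → IsA c → Valid m n c → index c ≤ m
valid-A-index A-cell (_ , u≤m) = u≤m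

valid-B-index : ∀ {m n c} → IsB c → Valid m n c → index c < m
valid-B-index B-cell (_ , v<m) = v<m


mark : ℕ → Cell → Bool
mark J (A _ u) = u ≤ᵇ J
mark J (B _ v) = J ≤ᵇ v

Entry : Set
Entry = ℕ × Cell

value : Entry → ℕ
value = proj₁

cell : Entry → Cell
cell = proj₂

data Consistent (marked : Cell → Bool) : Rel Entry 0ℓ where
  same-cell  : ∀ {u v s} → v < u → T (marked s) → Consistent marked (u , s) (v , s)
  later-cell : ∀ {u v s t} → s ≺ₚ t → (s ≺ᵥ t → u < v) → (t ≺ᵥ s → v < u) →
               Consistent marked (u , s) (v , t)

Descent : Rel Cell 0ℓ
Descent s t = s ≺ₚ t × t ≺ᵥ s

consistent-ascent : ∀ {e a b} → Consistent e a b → value a < value b → Ascent (cell a) (cell b)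
consistent-ascent (same-cell v<u _) u<v = contradiction v<u (<-asym u<v)
consistent-ascent {a = _ , s} {_ , t} (later-cell s≺t _ t≺s⇒) u<v with ≺ᵥ-trichotomy s t
... | inj₁ refl         = contradiction s≺t ≺ₚ-irrefl
... | inj₂ (inj₁ s≺ᵥt) = s≺t , s≺ᵥt
... | inj₂ (inj₂ t≺ᵥs) = contradiction (t≺s⇒ t≺ᵥs) (<-asym u<v)

consistent-descent : ∀ {e a b} → Consistent e a b → value b < value a →
                     (cell a ≡ cell b × T (e (cell a))) ⊎ Descent (cell a) (cell b)
consistent-descent (same-cell _ marked) _ = inj₁ (refl , marked)
consistent-descent {a = _ , s} {_ , t} (later-cell s≺t s≺t⇒ _) v<u with ≺ᵥ-trichotomy s t
... | inj₁ refl         = contradiction s≺t ≺ₚ-irrefl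
... | inj₂ (inj₁ s≺ᵥt) = contradiction (s≺t⇒ s≺ᵥt) (<-asym v<u)
... | inj₂ (inj₂ t≺ᵥs) = inj₂ (s≺t , t≺ᵥs)

northwest-of-ascent : ∀ {e x y z} → Ascent (cell x) (cell y) → value x < value y → value y < value z →
                      Consistent e z x → Consistent e z y → NorthWest (cell x) (cell y) (cell z)
northwest-of-ascent (x≺ₚy , x≺ᵥy) x<y y<z zx zy
  with consistent-descent zx (<-trans x<y y<z) | consistent-descent zy y<z
... | inj₁ (refl , _) | inj₁ (refl , _)   = contradiction x≺ₚy ≺ₚ-irrefl
... | inj₂ (z≺x , _)  | inj₁ (refl , _)   = contradiction z≺x (≺ₚ-asym x≺ₚy)
... | inj₁ (refl , _) | inj₂ (_ , y≺z)    = contradiction y≺z (≺ᵥ-asym x≺ᵥy)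
... | inj₂ (z≺x , _)  | inj₂ (_ , y≺z)    = z≺x , y≺z

southeast-of-ascent : ∀ {e x y w} → Ascent (cell x) (cell y) → value x < value y → value w < value x →
                      Consistent e x w → Consistent e y w → SouthEast (cell x) (cell y) (cell w)
southeast-of-ascent (x≺ₚy , x≺ᵥy) x<y w<x xw yw
  with consistent-descent xw w<x | consistent-descent yw (<-trans w<x x<y)
... | inj₁ (refl , _) | inj₁ (refl , _)   = contradiction x≺ₚy ≺ₚ-irrefl
... | inj₁ (refl , _) | inj₂ (y≺x , _)    = contradiction y≺x (≺ₚ-asym x≺ₚy)
... | inj₂ (_ , y≺x)  | inj₁ (refl , _)   = contradiction y≺x (≺ᵥ-asym x≺ᵥy)
... | inj₂ (_ , w≺x)  | inj₂ (y≺w , _)    = y≺w , w≺x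

DescendingStep : ℕ → Rel Entry 0ℓ
DescendingStep J a b = Consistent (mark J) a b × value b < value a

A-step : ∀ {J a b} → IsA (cell a) → IsA (cell b) → DescendingStep J a b →
         index (cell b) < index (cell a) ⊎ index (cell a) ≤ J
A-step {J} A-cell A-cell (cons , b<a) with consistent-descent cons b<a
... | inj₁ (refl , marked) = inj₂ (≤ᵇ⇒≤ _ J marked)
... | inj₂ (a≺b , b≺a)     = inj₁ (A-descent a≺b b≺a)

B-step : ∀ {J a b} → IsB (cell a) → IsB (cell b) → DescendingStep J a b →
         index (cell b) < index (cell a) ⊎ J ≤ index (cell a)
B-step {J} B-cell B-cell (cons , b<a) with consistent-descent cons b<a
... | inj₁ (refl , marked) = inj₂ (≤ᵇ⇒≤ J _ marked)
... | inj₂ (a≺b , b≺a)     = inj₁ (B-descent a≺b b≺a)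

consistent-avoids-alpha : ∀ {e n w} → AllPairs (Consistent e) w → All (λ z → layer (cell z) ≤ n) w →
                          Avoids (map value w) (alpha (2 + n))
consistent-avoids-alpha {n = n} {w} cons layers (_ , τ⊆ , iso) with ⊆-map⁻ value w τ⊆
... | τ , τ⊆w , refl with alpha-occurrence value (2 + n) iso
... | increasing , len = <-irrefl refl (subst (_≤ suc n) (trans (length-map (layer ∘ cell) τ) len)
                                  (increasing-length layers-increasing (Allₚ.map⁺ (All-resp-⊆ τ⊆w layers))))
  where
  layers-increasing : Linked _<_ (map (layer ∘ cell) τ)
  layers-increasing = Linkedₚ.map⁺ (Linked.zipWith (λ (c , <) → ascent-layer (consistent-ascent c <))
                                                   (AllPairs⇒Linked (AllPairs-resp-⊆ τ⊆w cons) , increasing))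

beta-impossible : ∀ {m n p q x y} → p + q ≡ suc m → Ascent x y →
  ∀ front → length front ≡ p → Linked (DescendingStep (pred q)) front →
  All (λ z → NorthWest x y (cell z) × Valid m n (cell z)) front →
  ∀ back → length back ≡ q → Linked (DescendingStep (pred q)) back →
  All (λ w → SouthEast x y (cell w) × Valid m n (cell w)) back → ⊥
beta-impossible p+q≡ _ [] refl _ _ [] refl _ _ = 0≢1+n p+q≡
beta-impossible {m} p+q≡ asc [] refl _ _ (w ∷ ws) refl back-chain back-facts@((se , valid) ∷ _) =
  <-irrefl refl (<-≤-trans (valid-B-index (southeast-isB asc se) valid) (begin
    m           ≡⟨ suc-injective p+q≡ ⟨
    length ws   ≤⟨ reduce (descending-chain-head (index ∘ cell) (length ws) B-step back-chain back-B) ⟩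
    index (cell w) ∎))
  where
  open ≤-Reasoning
  back-B = All.map (southeast-isB asc ∘ proj₁) back-facts
beta-impossible {q = q} p+q≡ asc (z ∷ zs) refl front-chain front-facts@((_ , valid) ∷ _) back lenB back-chain back-facts
  with All.lookupAny front-facts (descending-chain-reaches (index ∘ cell) q (λ pa pb r → Sum.map₂ ≤pred⇒≤ (A-step pa pb r))
                                                front-chain front-A bound)
  where
  front-A = All.map (northwest-isA asc ∘ proj₁) front-facts
  bound : index (cell z) ≤ q + length zs
  bound = ≤-trans (valid-A-index (All.head front-A) valid)
                  (≤-reflexive (sym (trans (+-comm q (length zs)) (suc-injective p+q≡))))
beta-impossible p+q≡ asc (z ∷ zs) refl _ _ [] refl _ _ | (nw , _) , a≤0 =
  <-irrefl refl (<-≤-trans (northwest-index>0 asc nw) a≤0)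
beta-impossible p+q≡ asc (z ∷ zs) refl _ _ (w ∷ ws) refl back-chain back-facts@((se , _) ∷ _) | (nw , _) , a≤q =
  <-irrefl refl (≤-trans (s≤s (s≤s w-start)) (≤-trans (northwest-southeast-gap asc nw se) a≤q))
  where
  w-start : length ws ≤ index (cell w)
  w-start = reduce (descending-chain-head (index ∘ cell) (length ws) B-step back-chain
                                          (All.map (southeast-isB asc ∘ proj₁) back-facts))

consistent-avoids-beta : ∀ {m n p q w} → p + q ≡ suc m → AllPairs (Consistent (mark (pred q))) w →
                         All (Valid m n ∘ cell) w → Avoids (map value w) (beta p q)
consistent-avoids-beta {m} {n} {p} {q} {w} p+q≡ cons valid (_ , τ⊆ , iso) with ⊆-map⁻ value w τ⊆
... | τ , τ⊆w , refl =
  beta-impossible p+q≡ asc front front-length front-chain front-facts back back-length back-chain back-facts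
  where
  open BetaOccurrence (beta-occurrence value p q iso)
  cons-τ = subst (AllPairs _) split (AllPairs-resp-⊆ τ⊆w cons)
  valid-τ = subst (All _) split (All-resp-⊆ τ⊆w valid)
  parts = AllPairs-++⁻ front cons-τ
  rest = proj₂ (proj₂ parts)
  from-x = AllPairs.head rest
  from-y = AllPairs.head (AllPairs.tail rest)
  asc = consistent-ascent (All.head from-x) x<y
  front-chain = Linked.zip (AllPairs⇒Linked (proj₁ parts) , front-decreasing)
  back-chain = Linked.zip (AllPairs⇒Linked (AllPairs.tail (AllPairs.tail rest)) , back-decreasing)
  front-facts : All (λ z → NorthWest (cell x) (cell y) (cell z) × Valid m n (cell z)) front
  front-facts = All.zipWith (λ ((from-z , y<z) , valid-z) →
                               northwest-of-ascent asc x<y y<z (All.head from-z) (All.head (All.tail from-z)) , valid-z)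
                            (All.zip (proj₁ (proj₂ parts) , front-above) , Allₚ.++⁻ˡ front valid-τ)
  back-facts : All (λ v → SouthEast (cell x) (cell y) (cell v) × Valid m n (cell v)) back
  back-facts = All.zipWith (λ (((xv , yv) , v<x) , valid-v) → southeast-of-ascent asc x<y v<x xv yv , valid-v)
                           (All.zip (All.zip (All.tail from-x , from-y) , back-below) ,
                            All.tail (All.tail (Allₚ.++⁻ʳ front valid-τ)))

consistent-InAv : ∀ {m n p q w} → p + q ≡ suc m → AllPairs (Consistent (mark (pred q))) w →
                  All (Valid m n ∘ cell) w → InAv (2 + n) p q (map value w)
consistent-InAv p+q≡ cons valid = consistent-avoids-alpha cons (All.map valid-layer valid) ,
                                  consistent-avoids-beta p+q≡ cons valid


module ValuedCells (f : Cell → ℕ) (C : List Cell) (f-mono : ∀ {s t} → s ∈ C → s ≺ᵥ t → f s < f t) where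

  labelled-consistent : ∀ {marked ts} → All (_∈ C) ts → AllPairs _≺ₚ_ ts →
                        AllPairs (Consistent marked) (map (λ t → f t , t) ts)
  labelled-consistent []          []          = []
  labelled-consistent (t∈C ∷ ts∈C) (t≺ ∷ ≺ts) =
    Allₚ.map⁺ (All.zipWith (λ (t′∈C , t≺t′) → later-cell t≺t′ (f-mono t∈C) (f-mono t′∈C)) (ts∈C , t≺)) ∷
    labelled-consistent ts∈C ≺ts

  module Inflation (N : ℕ) (marked : Cell → Bool) where

    weights : List (ℕ × Bool)
    weights = map (λ t → f t , marked t) C

    run : Cell → List Entry
    run t = map (_, t) (dec (base N weights (f t) + weight N (marked t)) (weight N (marked t)))

    inflate : List Cell → List Entry
    inflate []       = []
    inflate (t ∷ ts) = run t ++ inflate ts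

    expand≡inflate : expand N (map f C) (map marked C) ≡ map value (inflate C)
    expand≡inflate = begin
      expand N (map f C) (map marked C)               ≡⟨ expand≡blocks N (map f C) (map marked C) ⟩
      blocks N weights′ weights′                      ≡⟨ cong (λ ps → blocks N ps ps) (zip-map C) ⟩
      blocks N weights (map (λ t → f t , marked t) C) ≡⟨ blocks≡ C ⟩
      map value (inflate C)                           ∎
      where
      open ≡-Reasoning
      weights′ = zip (map f C) (map marked C)
      zip-map : ∀ ts → zip (map f ts) (map marked ts) ≡ map (λ t → f t , marked t) ts
      zip-map []       = refl
      zip-map (t ∷ ts) = cong (_ ∷_) (zip-map ts)
      value-run : ∀ t → map value (run t) ≡ dec (base N weights (f t) + weight N (marked t)) (weight N (marked t))
      value-run t = trans (sym (map-∘ _)) (map-id _)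
      blocks≡ : ∀ ts → blocks N weights (map (λ t → f t , marked t) ts) ≡ map value (inflate ts)
      blocks≡ []       = refl
      blocks≡ (t ∷ ts) = trans (cong₂ _++_ (sym (value-run t)) (blocks≡ ts)) (sym (map-++ value (run t) (inflate ts)))

    InRun : Entry → Set
    InRun (v , t) = base N weights (f t) < v × v ≤ base N weights (f t) + weight N (marked t)

    run-range : ∀ t → All (λ e → cell e ≡ t × InRun e) (run t)
    run-range t = Allₚ.map⁺ (All.zipWith (λ (above , ≤top) → refl , above , ≤top) (above-base , dec-≤ top w))
      where
      w = weight N (marked t)
      top = base N weights (f t) + w
      above-base : All (base N weights (f t) <_) (dec top w)
      above-base = subst (λ c → All (base N weights (f t) <_) (dec c w)) (+-comm w _) (dec-above _ w)

    runs-ordered : ∀ {u s v t} → s ∈ C → s ≺ᵥ t → InRun (u , s) → InRun (v , t) → u < v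
    runs-ordered s∈C s≺t (_ , u≤top) (above , _) =
      ≤-<-trans (≤-trans u≤top (base-step N (∈-map⁺ _ s∈C) (f-mono s∈C s≺t))) above

    run-consistent : ∀ t → AllPairs (Consistent marked) (run t)
    run-consistent t with marked t in marked-t
    ... | false = [] ∷ []
    ... | true  = AllPairsₚ.map⁺ (AllPairs.map (λ v<u → same-cell v<u (subst T (sym marked-t) tt)) descending)
      where
      descending : AllPairs _>_ (dec (base N weights (f t) + N) N)
      descending = Linkedₚ.Linked⇒AllPairs (flip <-trans)
                     (subst (λ c → Linked _>_ (dec c N)) (+-comm N _) (dec-decreasing _ N))

    inflate-cells : ∀ ts → All (λ e → cell e ∈ ts × InRun e) (inflate ts)
    inflate-cells []       = []
    inflate-cells (t ∷ ts) = Allₚ.++⁺ (All.map (λ { (refl , in-run) → here refl , in-run }) (run-range t))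
                                      (All.map (λ (∈ts , in-run) → there ∈ts , in-run) (inflate-cells ts))

    inflate-consistent : ∀ {ts} → All (_∈ C) ts → AllPairs _≺ₚ_ ts → AllPairs (Consistent marked) (inflate ts)
    inflate-consistent []           []         = []
    inflate-consistent {t ∷ ts} (t∈C ∷ ts∈C) (t≺ ∷ ≺ts) =
      AllPairsₚ.++⁺ (run-consistent t) (inflate-consistent ts∈C ≺ts) (All.map across (run-range t))
      where
      across : ∀ {e} → cell e ≡ t × InRun e → All (Consistent marked e) (inflate ts)
      across (refl , e-run) = All.map (λ (t′∈ts , e′-run) →
          later-cell (All.lookup t≺ t′∈ts) (λ t≺t′ → runs-ordered t∈C t≺t′ e-run e′-run)
                     (λ t′≺t → runs-ordered (All.lookup ts∈C t′∈ts) t′≺t e′-run e-run))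
        (inflate-cells ts)


-- The cells of θ in position order

A-run : ℕ → ℕ → List Cell
A-run k c = applyDownFrom (A k) (suc c)

B-run : ℕ → ℕ → List Cell
B-run k c = applyDownFrom (B k) c

mixed-run : ℕ → ℕ → List Cell → List Cell
mixed-run k zero    rest = A (suc k) 0 ∷ rest
mixed-run k (suc c) rest = A (suc k) (suc c) ∷ B k c ∷ mixed-run k c rest

segments : ℕ → ℕ → ℕ → List Cell
segments m k zero    = B-run k m
segments m k (suc j) = mixed-run k m (segments m (suc k) j)

cells : ℕ → ℕ → List Cell
cells m n = A-run 0 m ++ segments m 0 n

A-run-linked : ∀ {R : Rel Cell 0ℓ} {k rest} c → (∀ {i} → i < c → R (A k (suc i)) (A k i)) →
               Linked R (A k 0 ∷ rest) → Linked R (A-run k c ++ rest)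
A-run-linked zero    _    lnk = lnk
A-run-linked (suc c) step lnk = step ≤-refl ∷ A-run-linked c (step ∘ m<n⇒m<1+n) lnk

mixed-run-linked : ∀ {R : Rel Cell 0ℓ} {k x rest} c → R x (A (suc k) c) →
                   (∀ {i} → i < c → R (A (suc k) (suc i)) (B k i)) → (∀ {i} → R (B k i) (A (suc k) i)) →
                   Linked R (A (suc k) 0 ∷ rest) → Linked R (x ∷ mixed-run k c rest)
mixed-run-linked zero    x→ _  _  lnk = x→ ∷ lnk
mixed-run-linked (suc c) x→ ab ba lnk = x→ ∷ ab ≤-refl ∷ mixed-run-linked c ba (ab ∘ m<n⇒m<1+n) ba lnk

B-run-linked : ∀ {R : Rel Cell 0ℓ} {k x} c → (∀ {i} → suc i ≡ c → R x (B k i)) →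
               (∀ {i} → suc i < c → R (B k (suc i)) (B k i)) → Linked R (x ∷ B-run k c)
B-run-linked zero          _  _    = [-]
B-run-linked (suc zero)    x→ _    = x→ refl ∷ [-]
B-run-linked (suc (suc c)) x→ step = x→ refl ∷ B-run-linked (suc c) (λ { refl → step ≤-refl }) (step ∘ m<n⇒m<1+n)

Gapped : ℕ → ℕ → Rel Cell 0ℓ
Gapped m n s t = s ≺ᵥ t ⊎ ∃[ w ] Valid m n w × t ≺ᵥ w × w ≺ᵥ s

Step : ℕ → ℕ → Rel Cell 0ℓ
Step m n s t = s ≺ₚ t × Gapped m n s t

module _ {m n : ℕ} where

  step-A₀ : ∀ {i} → 0 < n → i < m → Step m n (A 0 (suc i)) (A 0 i)
  step-A₀ {i} 0<n i<m = same-segment refl (<-trans (even<odd i) (odd<even ≤-refl)) ,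
    inj₂ (B 1 i , (0<n , i<m) , same-block refl (even<odd i) , same-block refl (odd<even ≤-refl))

  step-AA : ∀ {k c} → Step m n (A k 0) (A (suc k) c)
  step-AA {k} = earlier-segment (n<1+n k) , inj₁ (lower-block (n<1+n (suc k)))

  step-AB : ∀ {k i} → k < n → Step m n (A (suc k) (suc i)) (B k i)
  step-AB {k} k<n = same-segment refl (odd<even ≤-refl) ,
    inj₂ (A k 0 , (<⇒≤ k<n , z≤n) , lower-block (n<1+n k) , lower-block (n<1+n (suc k)))

  step-BA : ∀ {k i} → Step m n (B k i) (A (suc k) i)
  step-BA {k} {i} = same-segment refl (even<odd i) , inj₁ (lower-block (m<n⇒m<1+n (n<1+n k)))

  step-AB-last : ∀ {k i} → k < n → i < m → Step m n (A (suc k) 0) (B (suc k) i)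
  step-AB-last {k} k<n i<m = earlier-segment (n<1+n (suc k)) ,
    inj₂ (A k m , (<⇒≤ k<n , ≤-refl) , same-block refl (odd<even i<m) , lower-block (n<1+n (suc k)))

  step-BB : ∀ {k i} → k < n → suc i < m → Step m n (B (suc k) (suc i)) (B (suc k) i)
  step-BB {k} {i} k<n i<m = same-segment refl (s≤s (<-trans (even<odd i) (odd<even ≤-refl))) ,
    inj₂ (A k (suc i) , (<⇒≤ k<n , <⇒≤ i<m) , same-block refl (odd<even ≤-refl) , same-block refl (even<odd (suc i)))

  segments-linked : ∀ k j → k + suc j ≡ n → Linked (Step m n) (A k 0 ∷ segments m k (suc j))
  segments-linked k j k+j≡n = mixed-run-linked m step-AA (λ _ → step-AB k<n) step-BA (rest-linked j k+j≡n)
    where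
    k<n : k < n
    k<n = <-≤-trans (m<m+n k (s≤s z≤n)) (≤-reflexive k+j≡n)
    rest-linked : ∀ j → k + suc j ≡ n → Linked (Step m n) (A (suc k) 0 ∷ segments m (suc k) j)
    rest-linked zero     _   = B-run-linked m (λ i+1≡m → step-AB-last k<n (≤-reflexive i+1≡m)) (step-BB k<n)
    rest-linked (suc j′) k+j≡n′ = segments-linked (suc k) j′ (trans (sym (+-suc k (suc j′))) k+j≡n′)

cells-linked : ∀ {m n} → 0 < n → Linked (Step m n) (cells m n)
cells-linked {m} {suc j} 0<n = A-run-linked m (step-A₀ 0<n) (segments-linked 0 j refl)

mixed-run-valid : ∀ {m n k c rest} → suc k ≤ n → c ≤ m → All (Valid m n) rest → All (Valid m n) (mixed-run k c rest)
mixed-run-valid {c = zero}  k<n _   valid = (k<n , z≤n) ∷ valid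
mixed-run-valid {c = suc c} k<n c<m valid = (k<n , c<m) ∷ (<⇒≤ k<n , c<m) ∷ mixed-run-valid k<n (<⇒≤ c<m) valid

segments-valid : ∀ {m n} k j → k + j ≡ n → All (Valid m n) (segments m k j)
segments-valid k zero    k+0≡n = Allₚ.applyDownFrom⁺₁ (B k) _ (λ i<m → k≤n , i<m)
  where k≤n = ≤-trans (m≤m+n k 0) (≤-reflexive k+0≡n)
segments-valid k (suc j) k+j≡n =
  mixed-run-valid (≤-trans (m<m+n k (s≤s z≤n)) (≤-reflexive k+j≡n)) ≤-refl
                  (segments-valid (suc k) j (trans (sym (+-suc k j)) k+j≡n))

cells-valid : ∀ m n → All (Valid m n) (cells m n)
cells-valid m n = Allₚ.++⁺ (Allₚ.applyDownFrom⁺₁ (A 0) (suc m) (λ i<1+m → z≤n , s≤s⁻¹ i<1+m)) (segments-valid 0 n refl)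

mixed-run-∈-A : ∀ {k i rest} c → i ≤ c → A (suc k) i ∈ mixed-run k c rest
mixed-run-∈-A zero    z≤n = here refl
mixed-run-∈-A (suc c) i≤1+c with m≤n⇒m<n∨m≡n i≤1+c
... | inj₁ i<1+c = there (there (mixed-run-∈-A c (s≤s⁻¹ i<1+c)))
... | inj₂ refl  = here refl

mixed-run-∈-B : ∀ {k i rest} c → i < c → B k i ∈ mixed-run k c rest
mixed-run-∈-B (suc c) i<1+c with m<1+n⇒m<n∨m≡n i<1+c
... | inj₁ i<c = there (there (mixed-run-∈-B c i<c))
... | inj₂ refl = there (here refl)

mixed-run-∈-rest : ∀ {k x rest} c → x ∈ rest → x ∈ mixed-run k c rest
mixed-run-∈-rest zero    x∈ = there x∈
mixed-run-∈-rest (suc c) x∈ = there (there (mixed-run-∈-rest c x∈))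

segments-∈-A : ∀ {m k′ i} k j → k < k′ → k′ ≤ k + j → i ≤ m → A k′ i ∈ segments m k j
segments-∈-A k zero    k<k′ k′≤k+0 _ = contradiction (≤-trans k′≤k+0 (≤-reflexive (+-identityʳ k))) (<⇒≱ k<k′)
segments-∈-A {m} k (suc j) k<k′ k′≤k+j i≤m with m≤n⇒m<n∨m≡n k<k′
... | inj₂ refl   = mixed-run-∈-A m i≤m
... | inj₁ 1+k<k′ = mixed-run-∈-rest m (segments-∈-A (suc k) j 1+k<k′ (≤-trans k′≤k+j (≤-reflexive (+-suc k j))) i≤m)

segments-∈-B : ∀ {m k′ i} k j → k ≤ k′ → k′ ≤ k + j → i < m → B k′ i ∈ segments m k j
segments-∈-B {m} {k′} k zero k≤k′ k′≤k+0 i<m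
  rewrite ≤-antisym k′≤k+0 (≤-trans (≤-reflexive (+-identityʳ k)) k≤k′) | +-identityʳ k = ∈-applyDownFrom⁺ (B k) i<m
segments-∈-B {m} k (suc j) k≤k′ k′≤k+j i<m with m≤n⇒m<n∨m≡n k≤k′
... | inj₂ refl = mixed-run-∈-B m i<m
... | inj₁ k<k′ = mixed-run-∈-rest m (segments-∈-B (suc k) j k<k′ (≤-trans k′≤k+j (≤-reflexive (+-suc k j))) i<m)

cells-complete : ∀ {m n c} → Valid m n c → c ∈ cells m n
cells-complete {m} {n} {A zero u}    (_ , u≤m)   = ∈-++⁺ˡ (∈-applyDownFrom⁺ (A 0) (s≤s u≤m))
cells-complete {m} {n} {A (suc k) u} (k<n , u≤m) = ∈-++⁺ʳ (A-run 0 m) (segments-∈-A 0 n (s≤s z≤n) k<n u≤m)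
cells-complete {m} {n} {B k v}       (k≤n , v<m) = ∈-++⁺ʳ (A-run 0 m) (segments-∈-B 0 n z≤n k≤n v<m)

length-mixed-run : ∀ k c rest → length (mixed-run k c rest) ≡ suc (2 * c) + length rest
length-mixed-run k zero    rest = cong suc (cong (_+ length rest) (sym (*-zeroʳ 2)))
length-mixed-run k (suc c) rest =
  trans (cong (suc ∘ suc) (length-mixed-run k c rest)) (cong (λ l → suc l + length rest) (sym (*-suc 2 c)))

length-segments : ∀ m k j → length (segments m k j) ≡ j * suc (2 * m) + m
length-segments m k zero    = length-applyDownFrom (B k) m
length-segments m k (suc j) = begin
  length (mixed-run k m (segments m (suc k) j))         ≡⟨ length-mixed-run k m _ ⟩
  suc (2 * m) + length (segments m (suc k) j)           ≡⟨ cong (suc (2 * m) +_) (length-segments m (suc k) j) ⟩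
  suc (2 * m) + (j * suc (2 * m) + m)                   ≡⟨ +-assoc (suc (2 * m)) _ m ⟨
  suc j * suc (2 * m) + m                               ∎
  where open ≡-Reasoning

length-cells : ∀ m n → length (cells m n) ≡ suc n * suc (2 * m)
length-cells m n = begin
  length (A-run 0 m ++ segments m 0 n)     ≡⟨ length-++ (A-run 0 m) ⟩
  length (A-run 0 m) + length (segments m 0 n) ≡⟨ cong₂ _+_ (length-applyDownFrom (A 0) (suc m)) (length-segments m 0 n) ⟩
  suc m + (n * suc (2 * m) + m)
    ≡⟨ solve 2 (λ m x → (con 1 :+ m) :+ (x :+ m) := (con 1 :+ con 2 :* m) :+ x) refl m (n * suc (2 * m)) ⟩
  suc (2 * m) + n * suc (2 * m)            ∎
  where open ≡-Reasoning

marks : ℕ → List Cell → ℕ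
marks J cs = count (map (mark J) cs)

count-∷ : ∀ b bs → count (b ∷ bs) ≡ (if b then 1 else 0) + count bs
count-∷ true  _ = refl
count-∷ false _ = refl

-- Exactly one of the cells A k (c + 1) and B k′ c is marked.
marked-once : ∀ J c → (if suc c ≤ᵇ J then 1 else 0) + (if J ≤ᵇ c then 1 else 0) ≡ 1
marked-once J c with suc c ≤ᵇ J | ≤ᵇ-reflects-≤ (suc c) J | J ≤ᵇ c | ≤ᵇ-reflects-≤ J c
... | true  | ofʸ c<J | true  | ofʸ J≤c = contradiction J≤c (<⇒≱ c<J)
... | true  | _       | false | _       = refl
... | false | _       | true  | _       = refl
... | false | ofⁿ c≮J | false | ofⁿ J≰c = contradiction (≰⇒> J≰c) c≮J

count-++ : ∀ bs cs → count (bs ++ cs) ≡ count bs + count cs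
count-++ []           cs = refl
count-++ (true ∷ bs)  cs = cong suc (count-++ bs cs)
count-++ (false ∷ bs) cs = count-++ bs cs

marks-mixed-run : ∀ J k c rest → marks J (mixed-run k c rest) ≡ suc c + marks J rest
marks-mixed-run J k zero    rest = refl
marks-mixed-run J k (suc c) rest = begin
  count (a ∷ b ∷ map (mark J) (mixed-run k c rest))            ≡⟨ count-∷ a _ ⟩
  ind a + count (b ∷ map (mark J) (mixed-run k c rest))        ≡⟨ cong (ind a +_) (count-∷ b _) ⟩
  ind a + (ind b + marks J (mixed-run k c rest))               ≡⟨ +-assoc (ind a) (ind b) _ ⟨
  (ind a + ind b) + marks J (mixed-run k c rest)               ≡⟨ cong₂ _+_ (marked-once J c) (marks-mixed-run J k c rest) ⟩
  suc (suc c + marks J rest)                                   ∎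
  where
  open ≡-Reasoning
  a = suc c ≤ᵇ J
  b = J ≤ᵇ c
  ind : Bool → ℕ
  ind x = if x then 1 else 0

marks-A-run-B-run : ∀ J k k′ c → marks J (A-run k c) + marks J (B-run k′ c) ≡ suc c
marks-A-run-B-run J k k′ zero    = refl
marks-A-run-B-run J k k′ (suc c) = begin
  count (a ∷ map (mark J) (A-run k c)) + count (b ∷ map (mark J) (B-run k′ c))
    ≡⟨ cong₂ _+_ (count-∷ a _) (count-∷ b _) ⟩
  (ind a + marks J (A-run k c)) + (ind b + marks J (B-run k′ c))
    ≡⟨ interchange (ind a) _ (ind b) _ ⟩
  (ind a + ind b) + (marks J (A-run k c) + marks J (B-run k′ c))
    ≡⟨ cong₂ _+_ (marked-once J c) (marks-A-run-B-run J k k′ c) ⟩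
  suc (suc c) ∎
  where
  open ≡-Reasoning
  a = suc c ≤ᵇ J
  b = J ≤ᵇ c
  ind : Bool → ℕ
  ind x = if x then 1 else 0

marks-segments : ∀ J m k′ k j → marks J (A-run k′ m) + marks J (segments m k j) ≡ suc j * suc m
marks-segments J m k′ k zero    = trans (marks-A-run-B-run J k′ k m) (sym (+-identityʳ (suc m)))
marks-segments J m k′ k (suc j) = begin
  marks J (A-run k′ m) + marks J (mixed-run k m (segments m (suc k) j))
    ≡⟨ cong (marks J (A-run k′ m) +_) (marks-mixed-run J k m _) ⟩
  marks J (A-run k′ m) + (suc m + marks J (segments m (suc k) j))
    ≡⟨ x∙yz≈y∙xz (marks J (A-run k′ m)) (suc m) _ ⟩
  suc m + (marks J (A-run k′ m) + marks J (segments m (suc k) j))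
    ≡⟨ cong (suc m +_) (marks-segments J m k′ (suc k) j) ⟩
  suc m + suc j * suc m ∎
  where open ≡-Reasoning

marks-cells : ∀ J m n → marks J (cells m n) ≡ suc n * suc m
marks-cells J m n = begin
  count (map (mark J) (A-run 0 m ++ segments m 0 n))             ≡⟨ cong count (map-++ (mark J) (A-run 0 m) _) ⟩
  count (map (mark J) (A-run 0 m) ++ map (mark J) (segments m 0 n)) ≡⟨ count-++ (map (mark J) (A-run 0 m)) _ ⟩
  marks J (A-run 0 m) + marks J (segments m 0 n)                 ≡⟨ marks-segments J m 0 0 n ⟩
  suc n * suc m                                                  ∎
  where open ≡-Reasoning


-- The permutation θ

module Construction (m n : ℕ) where

  slot-valid : ∀ {c} → Valid m n c → slot c < suc (2 * m)
  slot-valid {A _ _} (_ , u≤m) = s≤s (*-monoʳ-≤ 2 u≤m)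
  slot-valid {B _ _} (_ , v<m) = s≤s (<⇒≤ (odd<even v<m))

  code : Cell → ℕ
  code c = slot c + block c * suc (2 * m)

  code-mono : ∀ {s t} → Valid m n s → s ≺ᵥ t → code s < code t
  code-mono {s} {t} valid (lower-block β<) = begin-strict
    slot s + block s * W  <⟨ +-monoˡ-< _ (slot-valid valid) ⟩
    suc (block s) * W     ≤⟨ *-monoˡ-≤ W β< ⟩
    block t * W           ≤⟨ m≤n+m _ (slot t) ⟩
    slot t + block t * W  ∎
    where
    open ≤-Reasoning
    W = suc (2 * m)
  code-mono _ (same-block β≡ σ<) = +-mono-<-≤ σ< (≤-reflexive (cong (_* suc (2 * m)) β≡))

  code-injective : ∀ {s t} → Valid m n s → Valid m n t → code s ≡ code t → s ≡ t
  code-injective {s} {t} vs vt codes≡ with ≺ᵥ-trichotomy s t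
  ... | inj₁ s≡t         = s≡t
  ... | inj₂ (inj₁ s≺t) = contradiction codes≡ (<⇒≢ (code-mono vs s≺t))
  ... | inj₂ (inj₂ t≺s) = contradiction (sym codes≡) (<⇒≢ (code-mono vt t≺s))

  codes : List ℕ
  codes = map code (cells m n)

  val : Cell → ℕ
  val c = rank codes (code c)

  val-mono : ∀ {s t} → Valid m n s → s ≺ᵥ t → val s < val t
  val-mono vs s≺t = rank-strict (∈-map⁺ code (cells-complete vs)) (code-mono vs s≺t)

  step-val≢suc : ∀ {s t} → Valid m n s → Valid m n t → Step m n s t → val s ≢ suc (val t)
  step-val≢suc vs _  (_ , inj₁ s≺t) vs≡ = <-asym (val-mono vs s≺t) (≤-reflexive (sym vs≡))
  step-val≢suc _  vt (_ , inj₂ (w , vw , t≺w , w≺s)) vs≡ =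
    <-irrefl (sym vs≡) (≤-<-trans (val-mono vt t≺w) (val-mono vw w≺s))

  cells-sorted : 0 < n → AllPairs _≺ₚ_ (cells m n)
  cells-sorted 0<n = Linkedₚ.Linked⇒AllPairs ≺ₚ-trans (Linked.map proj₁ (cells-linked 0<n))

  val-mono-cells : ∀ {s t} → s ∈ cells m n → s ≺ᵥ t → val s < val t
  val-mono-cells s∈ = val-mono (All.lookup (cells-valid m n) s∈)

  open ValuedCells val (cells m n) val-mono-cells

  θ : List ℕ
  θ = map val (cells m n)

  θ-perm : 0 < n → IsPerm (suc n * suc (2 * m)) θ
  θ-perm 0<n = subst₂ _↭_ (sym (map-∘ (cells m n)))
                          (cong (map suc ∘ upTo) (trans (length-map code (cells m n)) (length-cells m n)))
                          (rank-↭ codes distinct)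
    where
    distinct : AllPairs _≢_ codes
    distinct = AllPairsₚ.map⁺ (AllPairs.map
      (λ (vs , vt , s≺t) codes≡ → ≺ₚ-irrefl (subst (_≺ₚ _) (code-injective vs vt codes≡) s≺t))
      (AllPairs-All (cells-valid m n) (cells-sorted 0<n)))

  θ-irreducible : 0 < n → Irreducible θ
  θ-irreducible 0<n = Linked⇒Irreducible (Linkedₚ.map⁺ (Linked.map (λ (vs , vt , step) → step-val≢suc vs vt step)
                                                                  (Linked-All (cells-valid m n) (cells-linked 0<n))))

  module _ (p q : ℕ) (p+q≡ : p + q ≡ suc m) (0<n : 0 < n) where

    E : List Bool
    E = map (mark (pred q)) (cells m n)

    θ-InAv : InAv (2 + n) p q θ
    θ-InAv = subst (InAv (2 + n) p q) (sym (map-∘ (cells m n)))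
      (consistent-InAv p+q≡ (labelled-consistent (All.tabulate id) (cells-sorted 0<n)) (Allₚ.map⁺ (cells-valid m n)))

    θ-expansible : Expansible (2 + n) p q θ E
    θ-expansible N = subst (InAv (2 + n) p q) (sym expand≡inflate)
      (consistent-InAv p+q≡ (inflate-consistent (All.tabulate id) (cells-sorted 0<n))
                             (All.map (λ (c∈ , _) → All.lookup (cells-valid m n) c∈) (inflate-cells (cells m n))))
      where open Inflation (suc N) (mark (pred q))

    E-length : length E ≡ length θ
    E-length = trans (length-map (mark (pred q)) (cells m n)) (sym (length-map val (cells m n)))

    E-count : count E ≡ suc n * suc m
    E-count = marks-cells (pred q) m n

permutation-length : ∀ m → 2 * (suc m + 2) ∸ 5 ≡ suc (2 * m)
permutation-length m = begin
  2 * (suc m + 2) ∸ 5          ≡⟨ cong (_∸ 5) (solve 1 (λ m → con 2 :* ((con 1 :+ m) :+ con 2) := con 5 :+ (con 1 :+ con 2 :* m)) refl m) ⟩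
  5 + suc (2 * m) ∸ 5          ≡⟨ m+n∸m≡n 5 (suc (2 * m)) ⟩
  suc (2 * m)                  ∎
  where open ≡-Reasoning

lemma4p3 : (r p q : ℕ) → 3 ≤ r → 1 ≤ p + q →
    Σ (List ℕ) λ θ →
      IsPerm ((r ∸ 1) * (2 * (p + q + 2) ∸ 5)) θ × Irreducible θ × InAv r p q θ ×
      Σ (List Bool) λ E →
        (length E ≡ length θ) × (count E ≡ (r ∸ 1) * ((p + q + 2) ∸ 2)) × Expansible r p q θ E
lemma4p3 (suc (suc (suc r₀))) p q _ 0<p+q =
  θ , perm , θ-irreducible 0<n , θ-InAv p q p+q≡ 0<n ,
  E p q p+q≡ 0<n , E-length p q p+q≡ 0<n , count-E , θ-expansible p q p+q≡ 0<n
  where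
  n = suc r₀
  m = pred (p + q)
  open Construction m n
  0<n : 0 < n
  0<n = s≤s z≤n
  p+q≡ : p + q ≡ suc m
  p+q≡ = sym (suc-pred (p + q) {{>-nonZero 0<p+q}})
  perm : IsPerm (suc n * (2 * (p + q + 2) ∸ 5)) θ
  perm = subst (λ l → IsPerm (suc n * l) θ)
               (sym (trans (cong (λ s → 2 * (s + 2) ∸ 5) p+q≡) (permutation-length m))) (θ-perm 0<n)
  count-E : count (E p q p+q≡ 0<n) ≡ suc n * (p + q + 2 ∸ 2)
  count-E = trans (E-count p q p+q≡ 0<n) (cong (suc n *_) (sym (trans (m+n∸n≡m (p + q) 2) p+q≡)))
lemma4p3 0             _ _ ()                _
lemma4p3 1             _ _ (s≤s ())          _
lemma4p3 2             _ _ (s≤s (s≤s ()))    _
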